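{- Let $n\geq 2$, let $\pi$ be an even Maass cusp form for $SL(n,\mathbb{Z})$ with Fourier–Whittaker coefficients $A(m_1,\dots,m_{n-1})$, let $q$ be a prime and $1\le k\le n-1$. With $$H_l(s,q)=\sum_{i=l}^{n-1} (-1)^{i}\frac{A(1,\dots,1,\overset{ \text{position }i}{\overbrace{q,1,\dots,1}})}{q^{is}}+\frac{(-1)^n}{q^{ns}},\qquad \tilde H_l(s,q)=\sum_{i=l}^{n-1} (-1)^{i}\frac{A(\overset{\text{position } i}{\overbrace{1,\dots,1,q}},1,\dots,1)}{q^{is}}+\frac{(-1)^n}{q^{ns}},$$ one has the identity of Dirichlet polynomials \begin{multline*} \frac{1}{q}+H_1(s,q)+\sum_{2\leq l\leq k}(q^{l-1}-q^{l-2})H_l(s,q)\\ =(-1)^n q^{k-ns}\left(\frac{1}{q}+\tilde H_1(1-s,q)+\sum_{2\leq l\leq n- k}(q^{l-1}-q^{l-2})\tilde H_l(1-s,q)\right). \end{multline*}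
   Context: $A(1,\dots,1,\overset{ \text{position }i}{\overbrace{q,1,\dots,1}})$ denotes $A(m_1,\dots,m_{n-1})$ with $m_{n-i}=q$ (the $i$-th entry counted from the right) and all other entries $1$; $A(\overset{\text{position } i}{\overbrace{1,\dots,1,q}},1,\dots,1)$ denotes $A(m_1,\dots,m_{n-1})$ with $m_i=q$ (the $i$-th entry counted from the left) and all other entries $1$. -}

module Defs where

open import Level using (Level)
open import Data.Nat as ℕ using (ℕ; zero; suc; _∸_; _≟_)
open import Data.Fin using (Fin; toℕ)
open import Data.List using (List; map; upTo; foldr)
open import Relation.Nullary using (yes; no)
open import Algebra.Bundles using (CommutativeRing)

-- Index vector (m_1,…,m_{n-1}) with m_j = q at position j counted from the
-- LEFT (1-based), all other entries 1.  Entry t : Fin (n ∸ 1) is m_{t+1}.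
qAtLeft : (n q j : ℕ) → Fin (n ∸ 1) → ℕ
qAtLeft n q j t with suc (toℕ t) ≟ j
... | yes _ = q
... | no  _ = 1

-- Position i counted from the RIGHT: m_{n-i} = q.
qAtRight : (n q i : ℕ) → Fin (n ∸ 1) → ℕ
qAtRight n q i = qAtLeft n q (n ∸ i)

range : ℕ → ℕ → List ℕ
range a b = map (a ℕ.+_) (upTo (suc b ∸ a))

module DirichletPoly {c ℓ : Level} (R : CommutativeRing c ℓ) where
  open CommutativeRing R

  pow : Carrier → ℕ → Carrier
  pow x zero    = 1#
  pow x (suc k) = x * pow x k

  ι : ℕ → Carrier
  ι zero    = 0#
  ι (suc k) = 1# + ι k

  sign : ℕ → Carrier
  sign i = pow (- 1#) i

  sumFromTo : (ℕ → Carrier) → ℕ → ℕ → Carrier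
  sumFromTo f a b = foldr _+_ 0# (map f (range a b))

  -- H_l(s,q) with y standing for q^{-s}:
  --   Σ_{i=l}^{n-1} (-1)^i A(…q at position i from right…) y^i + (-1)^n y^n
  H : (n q : ℕ) (A : (Fin (n ∸ 1) → ℕ) → Carrier) → ℕ → Carrier → Carrier
  H n q A l y =
    sumFromTo (λ i → sign i * A (qAtRight n q i) * pow y i) l (n ∸ 1)
    + sign n * pow y n

  H̃ : (n q : ℕ) (A : (Fin (n ∸ 1) → ℕ) → Carrier) → ℕ → Carrier → Carrier
  H̃ n q A l y =
    sumFromTo (λ i → sign i * A (qAtLeft n q i) * pow y i) l (n ∸ 1)
    + sign n * pow y n

  -- 1/q + G_1(y) + Σ_{2≤l≤K} (q^{l-1} - q^{l-2}) G_l(y),  qinv standing for 1/q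
  side : (q : ℕ) (qinv : Carrier) (G : ℕ → Carrier → Carrier) (K : ℕ)
         (y : Carrier) → Carrier
  side q qinv G K y =
    qinv + G 1 y
    + sumFromTo (λ l → (ι (q ℕ.^ (l ∸ 1)) - ι (q ℕ.^ (l ∸ 2))) * G l y) 2 K

module Submission where

-- Write x for q^{-s}, so that q^{-(1-s)} = 1/(q x).  Both sides of the
-- identity are of the form
--   side_K(G) = 1/q + G_1 + Σ_{l=2}^{K} (q^{l-1} - q^{l-2}) G_l
-- with G_l = Σ_{i=l}^{N} f_i + E a tail sum (N = n-1, E of degree n).
-- Summation by parts turns this into the closed form
--   side_K(G) = 1/q + Σ_{i=1}^{N} q^{min(i,K)-1} f_i + q^{K-1} E ,
-- so each side is a sum of monomials with explicit weights.  Multiplying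
-- the right-hand closed form (K = n-k, variable 1/(qx)) by
-- (-1)^n q^k x^n and reindexing i ↦ n - i matches it monomial by
-- monomial with the left-hand one (K = k, variable x): the coefficients
-- agree because A(q at position i from the right) is by definition
-- A(q at position n-i from the left), and the weights agree because
-- addition distributes over min.  The two boundary terms 1/q and
-- q^{K-1}E are exchanged.  No property of A (nor primality of q) is used.

open import Defs
open import Level using (Level)
open import Data.Nat using (ℕ; _≤_; _∸_)
open import Data.Nat.Primality using (Prime)
open import Data.Fin using (Fin)
open import Algebra.Bundles using (CommutativeRing)

open import Data.Nat as ℕ using (zero; suc; _<_; _⊓_; z≤n; s≤s)
import Data.Nat.Properties as ℕₚ
open import Data.Product using (_,_)
open import Data.List using (map; foldr; applyUpTo)
open import Relation.Binary.PropositionalEquality as ≡ using (_≡_)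

-- Exponent bookkeeping for the weights of reflected monomials: if
-- i + j = a + b then (a+1) + min(j,b) = min(i,a) + (j+1), since
-- a + min(j,b) = min(a+j, i+j) = min(a,i) + j.
weight-balance : ∀ a b i j → i ℕ.+ j ≡ a ℕ.+ b → suc a ℕ.+ j ⊓ b ≡ i ⊓ a ℕ.+ suc j
weight-balance a b i j i+j≡a+b =
  ≡.trans (≡.cong suc a+min≡min+j) (≡.sym (ℕₚ.+-suc (i ⊓ a) j))
  where
  open ≡.≡-Reasoning
  a+min≡min+j : a ℕ.+ j ⊓ b ≡ i ⊓ a ℕ.+ j
  a+min≡min+j = begin
    a ℕ.+ j ⊓ b              ≡⟨ ℕₚ.+-distribˡ-⊓ a j b ⟩
    (a ℕ.+ j) ⊓ (a ℕ.+ b)    ≡⟨ ≡.cong ((a ℕ.+ j) ⊓_) i+j≡a+b ⟨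
    (a ℕ.+ j) ⊓ (i ℕ.+ j)    ≡⟨ ℕₚ.+-distribʳ-⊓ j a i ⟨
    a ⊓ i ℕ.+ j              ≡⟨ ≡.cong (ℕ._+ j) (ℕₚ.⊓-comm a i) ⟩
    i ⊓ a ℕ.+ j              ∎

module FunctionalEquation {c ℓ : Level} (R : CommutativeRing c ℓ) where
  open CommutativeRing R
  open DirichletPoly R
  open import Relation.Binary.Reasoning.Setoid setoid
  open import Algebra.Solver.Ring.NaturalCoefficients.Default commutativeSemiring
    using (solve; _:+_; _:*_; _:=_)
  open import Algebra.Properties.CommutativeSemiring.Exp commutativeSemiring
    using (_^_; ^-homo-*; ^-distrib-*)
  open import Algebra.Properties.Semiring.Mult semiring using (_×_; ×1-homo-*)
  open import Algebra.Properties.Ring ring using (-1*x≈-x; -‿involutive)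
  open import Algebra.Properties.Group +-group using (//-rightDividesˡ)

  pow≡^ : ∀ u m → pow u m ≡ u ^ m
  pow≡^ u zero    = ≡.refl
  pow≡^ u (suc m) = ≡.cong (u *_) (pow≡^ u m)

  ι≡× : ∀ m → ι m ≡ m × 1#
  ι≡× zero    = ≡.refl
  ι≡× (suc m) = ≡.cong (1# +_) (ι≡× m)

  pow-+ : ∀ u m n → pow u (m ℕ.+ n) ≈ pow u m * pow u n
  pow-+ u m n = begin
    pow u (m ℕ.+ n)    ≡⟨ pow≡^ u (m ℕ.+ n) ⟩
    u ^ (m ℕ.+ n)      ≈⟨ ^-homo-* u m n ⟩
    u ^ m * u ^ n      ≡⟨ ≡.cong₂ _*_ (pow≡^ u m) (pow≡^ u n) ⟨
    pow u m * pow u n  ∎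

  pow-* : ∀ u v m → pow (u * v) m ≈ pow u m * pow v m
  pow-* u v m = begin
    pow (u * v) m      ≡⟨ pow≡^ (u * v) m ⟩
    (u * v) ^ m        ≈⟨ ^-distrib-* u v m ⟩
    u ^ m * v ^ m      ≡⟨ ≡.cong₂ _*_ (pow≡^ u m) (pow≡^ v m) ⟨
    pow u m * pow v m  ∎

  ι-* : ∀ m n → ι (m ℕ.* n) ≈ ι m * ι n
  ι-* m n = begin
    ι (m ℕ.* n)            ≡⟨ ι≡× (m ℕ.* n) ⟩
    (m ℕ.* n) × 1#         ≈⟨ ×1-homo-* m n ⟩
    (m × 1#) * (n × 1#)    ≡⟨ ≡.cong₂ _*_ (ι≡× m) (ι≡× n) ⟨
    ι m * ι n              ∎

  ι-pow : ∀ q m → ι (q ℕ.^ m) ≈ pow (ι q) m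
  ι-pow q zero    = +-identityʳ 1#
  ι-pow q (suc m) = trans (ι-* q (q ℕ.^ m)) (*-congˡ (ι-pow q m))

  pow-inverse : ∀ {u v} → u * v ≈ 1# → ∀ m → pow u m * pow v m ≈ 1#
  pow-inverse {u} {v} uv≈1 zero    = *-identityˡ 1#
  pow-inverse {u} {v} uv≈1 (suc m) = begin
    (u * pow u m) * (v * pow v m)  ≈⟨ solve 4 (λ u v U V → (u :* U) :* (v :* V) := (u :* v) :* (U :* V))
                                        refl u v (pow u m) (pow v m) ⟩
    (u * v) * (pow u m * pow v m)  ≈⟨ *-cong uv≈1 (pow-inverse uv≈1 m) ⟩
    1# * 1#                        ≈⟨ *-identityˡ 1# ⟩
    1#                             ∎

  -- ... hence u^{m+n} v^n = u^m.  This one identity governs the signs,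
  -- the powers of q and the powers of x in the reflection below.
  cancel-powers : ∀ {u v} → u * v ≈ 1# → ∀ m n → pow u (m ℕ.+ n) * pow v n ≈ pow u m
  cancel-powers {u} {v} uv≈1 m n = begin
    pow u (m ℕ.+ n) * pow v n        ≈⟨ *-congʳ (pow-+ u m n) ⟩
    (pow u m * pow u n) * pow v n    ≈⟨ *-assoc _ _ _ ⟩
    pow u m * (pow u n * pow v n)    ≈⟨ *-congˡ (pow-inverse uv≈1 n) ⟩
    pow u m * 1#                     ≈⟨ *-identityʳ _ ⟩
    pow u m                          ∎

  -1*-1≈1 : - 1# * - 1# ≈ 1#
  -1*-1≈1 = trans (-1*x≈-x (- 1#)) (-‿involutive 1#)

  sumBelow : (ℕ → Carrier) → ℕ → Carrier
  sumBelow g zero    = 0#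
  sumBelow g (suc m) = g 0 + sumBelow (λ i → g (suc i)) m

  sumBelow-applyUpTo : ∀ (f : ℕ → Carrier) (g h : ℕ → ℕ) m →
    foldr _+_ 0# (map f (map g (applyUpTo h m))) ≡ sumBelow (λ i → f (g (h i))) m
  sumBelow-applyUpTo f g h zero    = ≡.refl
  sumBelow-applyUpTo f g h (suc m) = ≡.cong (f (g (h 0)) +_) (sumBelow-applyUpTo f g (λ i → h (suc i)) m)

  sumFromTo≡sumBelow : ∀ f a b → sumFromTo f a b ≡ sumBelow (λ i → f (a ℕ.+ i)) (suc b ∸ a)
  sumFromTo≡sumBelow f a b = sumBelow-applyUpTo f (a ℕ.+_) (λ i → i) (suc b ∸ a)

  sumBelow-cong : ∀ {g h} m → (∀ i → i < m → g i ≈ h i) → sumBelow g m ≈ sumBelow h m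
  sumBelow-cong zero    g≈h = refl
  sumBelow-cong (suc m) g≈h = +-cong (g≈h 0 (s≤s z≤n)) (sumBelow-cong m (λ i i<m → g≈h (suc i) (s≤s i<m)))

  sumBelow-snoc : ∀ g m → sumBelow g (suc m) ≈ sumBelow g m + g m
  sumBelow-snoc g zero    = +-comm _ _
  sumBelow-snoc g (suc m) = trans (+-congˡ (sumBelow-snoc (λ i → g (suc i)) m)) (sym (+-assoc _ _ _))

  sumBelow-split : ∀ g a b → sumBelow g (a ℕ.+ b) ≈ sumBelow g a + sumBelow (λ i → g (a ℕ.+ i)) b
  sumBelow-split g zero    b = sym (+-identityˡ _)
  sumBelow-split g (suc a) b = trans (+-congˡ (sumBelow-split (λ i → g (suc i)) a b)) (sym (+-assoc _ _ _))

  sumBelow-scale : ∀ u g m → u * sumBelow g m ≈ sumBelow (λ i → u * g i) m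
  sumBelow-scale u g zero    = zeroʳ u
  sumBelow-scale u g (suc m) = trans (distribˡ _ _ _) (+-congˡ (sumBelow-scale u (λ i → g (suc i)) m))

  sumBelow-reverse : ∀ g m → sumBelow g m ≈ sumBelow (λ i → g (m ∸ suc i)) m
  sumBelow-reverse g zero    = refl
  sumBelow-reverse g (suc m) = begin
    g 0 + sumBelow (λ i → g (suc i)) m            ≈⟨ +-congˡ (sumBelow-reverse (λ i → g (suc i)) m) ⟩
    g 0 + sumBelow (λ i → g (suc (m ∸ suc i))) m  ≈⟨ +-congˡ (sumBelow-cong m (λ i i<m →
                                                        reflexive (≡.cong g (≡.sym (ℕₚ.+-∸-assoc 1 i<m))))) ⟩
    g 0 + sumBelow (λ i → g (m ∸ i)) m            ≈⟨ +-comm _ _ ⟩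
    sumBelow (λ i → g (m ∸ i)) m + g 0            ≡⟨ ≡.cong (λ j → sumBelow (λ i → g (m ∸ i)) m + g j) (ℕₚ.n∸n≡0 m) ⟨
    sumBelow (λ i → g (m ∸ i)) m + g (m ∸ m)      ≈⟨ sumBelow-snoc (λ i → g (m ∸ i)) m ⟨
    sumBelow (λ i → g (suc m ∸ suc i)) (suc m)    ∎

  sumFromTo-peel : ∀ f a b → a ≤ b → sumFromTo f a b ≈ f a + sumFromTo f (suc a) b
  sumFromTo-peel f a b a≤b = begin
    sumFromTo f a b                                     ≡⟨ sumFromTo≡sumBelow f a b ⟩
    sumBelow (λ i → f (a ℕ.+ i)) (suc b ∸ a)            ≡⟨ ≡.cong (sumBelow (λ i → f (a ℕ.+ i))) (ℕₚ.+-∸-assoc 1 a≤b) ⟩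
    f (a ℕ.+ 0) + sumBelow (λ i → f (a ℕ.+ suc i)) (b ∸ a)
      ≈⟨ +-cong (reflexive (≡.cong f (ℕₚ.+-identityʳ a)))
                (sumBelow-cong (b ∸ a) (λ i _ → reflexive (≡.cong f (ℕₚ.+-suc a i)))) ⟩
    f a + sumBelow (λ i → f (suc a ℕ.+ i)) (b ∸ a)      ≡⟨ ≡.cong (f a +_) (sumFromTo≡sumBelow f (suc a) b) ⟨
    f a + sumFromTo f (suc a) b                         ∎

  summation-by-parts : ∀ (w f G : ℕ → Carrier) → w 0 ≈ 1# → ∀ K →
    (∀ i → i < K → G (suc i) ≈ f (suc i) + G (suc (suc i))) →
    G 1 + sumFromTo (λ l → (w (l ∸ 1) - w (l ∸ 2)) * G l) 2 (suc K)
      ≈ sumBelow (λ i → w i * f (suc i)) K + w K * G (suc K)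
  summation-by-parts w f G w0≈1 zero _ = begin
    G 1 + 0#        ≈⟨ +-identityʳ _ ⟩
    G 1             ≈⟨ *-identityˡ _ ⟨
    1# * G 1        ≈⟨ *-congʳ w0≈1 ⟨
    w 0 * G 1       ≈⟨ +-identityˡ _ ⟨
    0# + w 0 * G 1  ∎
  summation-by-parts w f G w0≈1 (suc K) peel = begin
    G 1 + sumFromTo weighted 2 (suc (suc K))
      ≡⟨ ≡.cong (G 1 +_) (sumFromTo≡sumBelow weighted 2 (suc (suc K))) ⟩
    G 1 + sumBelow (λ i → weighted (2 ℕ.+ i)) (suc K)
      ≈⟨ +-congˡ (sumBelow-snoc (λ i → weighted (2 ℕ.+ i)) K) ⟩
    G 1 + (sumBelow (λ i → weighted (2 ℕ.+ i)) K + weighted (2 ℕ.+ K))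
      ≡⟨ ≡.cong (λ s → G 1 + (s + weighted (2 ℕ.+ K))) (sumFromTo≡sumBelow weighted 2 (suc K)) ⟨
    G 1 + (sumFromTo weighted 2 (suc K) + weighted (2 ℕ.+ K))
      ≈⟨ +-assoc _ _ _ ⟨
    (G 1 + sumFromTo weighted 2 (suc K)) + weighted (2 ℕ.+ K)
      ≈⟨ +-congʳ (summation-by-parts w f G w0≈1 K (λ i i<K → peel i (ℕₚ.m<n⇒m<1+n i<K))) ⟩
    (S + w K * G (suc K)) + d * G (2 ℕ.+ K)
      ≈⟨ +-congʳ (+-congˡ (*-congˡ (peel K (ℕₚ.n<1+n K)))) ⟩
    (S + w K * (f (suc K) + G (2 ℕ.+ K))) + d * G (2 ℕ.+ K)
      ≈⟨ solve 5 (λ S wK F G d → (S :+ wK :* (F :+ G)) :+ d :* G := (S :+ wK :* F) :+ (d :+ wK) :* G)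
               refl S (w K) (f (suc K)) (G (2 ℕ.+ K)) d ⟩
    (S + w K * f (suc K)) + (d + w K) * G (2 ℕ.+ K)
      ≈⟨ +-cong (sym (sumBelow-snoc (λ i → w i * f (suc i)) K)) (*-congʳ (//-rightDividesˡ (w K) (w (suc K)))) ⟩
    sumBelow (λ i → w i * f (suc i)) (suc K) + w (suc K) * G (2 ℕ.+ K)  ∎
    where
    weighted : ℕ → Carrier
    weighted l = (w (l ∸ 1) - w (l ∸ 2)) * G l
    S d : Carrier
    S = sumBelow (λ i → w i * f (suc i)) K
    d = w (suc K) - w K

  truncate-weights : ∀ (w g : ℕ → Carrier) K N → K ≤ N →
    sumBelow (λ i → w i * g i) K + w K * sumBelow (λ i → g (K ℕ.+ i)) (N ∸ K)
      ≈ sumBelow (λ i → w (i ⊓ K) * g i) N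
  truncate-weights w g K N K≤N = begin
    sumBelow (λ i → w i * g i) K + w K * sumBelow (λ i → g (K ℕ.+ i)) (N ∸ K)
      ≈⟨ +-congˡ (sumBelow-scale (w K) (λ i → g (K ℕ.+ i)) (N ∸ K)) ⟩
    sumBelow (λ i → w i * g i) K + sumBelow (λ i → w K * g (K ℕ.+ i)) (N ∸ K)
      ≈⟨ +-cong (sumBelow-cong K below) (sumBelow-cong (N ∸ K) above) ⟩
    sumBelow h K + sumBelow (λ i → h (K ℕ.+ i)) (N ∸ K)
      ≈⟨ sumBelow-split h K (N ∸ K) ⟨
    sumBelow h (K ℕ.+ (N ∸ K))
      ≡⟨ ≡.cong (sumBelow h) (ℕₚ.m+[n∸m]≡n K≤N) ⟩
    sumBelow h N  ∎
    where
    h : ℕ → Carrier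
    h i = w (i ⊓ K) * g i
    below : ∀ i → i < K → w i * g i ≈ h i
    below i i<K = *-congʳ (reflexive (≡.cong w (≡.sym (ℕₚ.m≤n⇒m⊓n≡m (ℕₚ.<⇒≤ i<K)))))
    above : ∀ i → i < N ∸ K → w K * g (K ℕ.+ i) ≈ h (K ℕ.+ i)
    above i _ = *-congʳ (reflexive (≡.cong w (≡.sym (ℕₚ.m≥n⇒m⊓n≡n (ℕₚ.m≤m+n K i)))))

  side-closed-form : ∀ q qinv (f : ℕ → Carrier) (E y : Carrier) N K → K ≤ N →
    side q qinv (λ l _ → sumFromTo f l N + E) (suc K) y
      ≈ qinv + (sumBelow (λ i → pow (ι q) (i ⊓ K) * f (suc i)) N + pow (ι q) K * E)
  side-closed-form q qinv f E y N K K≤N = begin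
    qinv + G 1 + sumFromTo (λ l → (w (l ∸ 1) - w (l ∸ 2)) * G l) 2 (suc K)
      ≈⟨ +-assoc _ _ _ ⟩
    qinv + (G 1 + sumFromTo (λ l → (w (l ∸ 1) - w (l ∸ 2)) * G l) 2 (suc K))
      ≈⟨ +-congˡ (summation-by-parts w f G (+-identityʳ 1#) K peel) ⟩
    qinv + (sumBelow (λ i → w i * f (suc i)) K + w K * (sumFromTo f (suc K) N + E))
      ≈⟨ +-congˡ (trans (+-congˡ (distribˡ _ _ _)) (sym (+-assoc _ _ _))) ⟩
    qinv + ((sumBelow (λ i → w i * f (suc i)) K + w K * sumFromTo f (suc K) N) + w K * E)
      ≡⟨ ≡.cong (λ s → qinv + ((sumBelow (λ i → w i * f (suc i)) K + w K * s) + w K * E))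
                (sumFromTo≡sumBelow f (suc K) N) ⟩
    qinv + ((sumBelow (λ i → w i * f (suc i)) K + w K * sumBelow (λ i → f (suc (K ℕ.+ i))) (N ∸ K)) + w K * E)
      ≈⟨ +-congˡ (+-congʳ (truncate-weights w (λ i → f (suc i)) K N K≤N)) ⟩
    qinv + (sumBelow (λ i → w (i ⊓ K) * f (suc i)) N + w K * E)
      ≈⟨ +-congˡ (+-cong (sumBelow-cong N (λ i _ → *-congʳ (ι-pow q (i ⊓ K)))) (*-congʳ (ι-pow q K))) ⟩
    qinv + (sumBelow (λ i → pow (ι q) (i ⊓ K) * f (suc i)) N + pow (ι q) K * E)  ∎
    where
    w : ℕ → Carrier
    w i = ι (q ℕ.^ i)
    G : ℕ → Carrier
    G l = sumFromTo f l N + E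
    peel : ∀ i → i < K → G (suc i) ≈ f (suc i) + G (suc (suc i))
    peel i i<K = trans (+-congʳ (sumFromTo-peel f (suc i) N (ℕₚ.≤-trans i<K K≤N))) (+-assoc _ _ _)


  -- The reflection i ↦ n - i, for n = a + b + 2, k = a + 1 and n - k = b + 1.
  module Reflection (a b q : ℕ) (A : (Fin (suc (a ℕ.+ b)) → ℕ) → Carrier)
                    (qinv : Carrier) (q·qinv≈1 : ι q * qinv ≈ 1#)
                    (x xinv : Carrier) (x·xinv≈1 : x * xinv ≈ 1#) where
    n N : ℕ
    n = suc (suc (a ℕ.+ b))
    N = suc (a ℕ.+ b)

    Q y P : Carrier
    Q = ι q
    y = qinv * xinv
    P = sign n * pow Q (suc a) * pow x n

    f g : ℕ → Carrier
    f i = sign i * A (qAtRight n q i) * pow x i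
    g j = sign j * A (qAtLeft n q j) * pow y j

    E Ẽ : Carrier
    E = sign n * pow x n
    Ẽ = sign n * pow y n

    reflect-monomial : ∀ i j → i ℕ.+ j ≡ a ℕ.+ b → ∀ α →
      P * (pow Q (j ⊓ b) * (sign (suc j) * α * pow y (suc j)))
        ≈ pow Q (i ⊓ a) * (sign (suc i) * α * pow x (suc i))
    reflect-monomial i j i+j≡a+b α = begin
      P * (pow Q (j ⊓ b) * (sign J * α * pow y J))
        ≈⟨ *-congˡ (*-congˡ (*-congˡ (pow-* qinv xinv J))) ⟩
      sign n * pow Q (suc a) * pow x n * (pow Q (j ⊓ b) * (sign J * α * (pow qinv J * pow xinv J)))
        ≈⟨ solve 8 (λ sn Qa xn Qj sJ α qJ xJ →
                      sn :* Qa :* xn :* (Qj :* (sJ :* α :* (qJ :* xJ)))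
                      := α :* (sn :* sJ) :* ((Qa :* Qj) :* qJ) :* (xn :* xJ))
                 refl (sign n) (pow Q (suc a)) (pow x n) (pow Q (j ⊓ b)) (sign J) α (pow qinv J) (pow xinv J) ⟩
      α * (sign n * sign J) * ((pow Q (suc a) * pow Q (j ⊓ b)) * pow qinv J) * (pow x n * pow xinv J)
        ≈⟨ *-cong (*-cong (*-congˡ signs) weights) powers-of-x ⟩
      α * sign I * pow Q (i ⊓ a) * pow x I
        ≈⟨ solve 4 (λ α sI Qi xI → α :* sI :* Qi :* xI := Qi :* (sI :* α :* xI))
                 refl α (sign I) (pow Q (i ⊓ a)) (pow x I) ⟩
      pow Q (i ⊓ a) * (sign I * α * pow x I)  ∎
      where
      I J : ℕ
      I = suc i
      J = suc j
      n≡I+J : n ≡ I ℕ.+ J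
      n≡I+J = ≡.cong suc (≡.trans (≡.cong suc (≡.sym i+j≡a+b)) (≡.sym (ℕₚ.+-suc i j)))
      signs : sign n * sign J ≈ sign I
      signs = trans (*-congʳ (reflexive (≡.cong sign n≡I+J))) (cancel-powers -1*-1≈1 I J)
      powers-of-x : pow x n * pow xinv J ≈ pow x I
      powers-of-x = trans (*-congʳ (reflexive (≡.cong (pow x) n≡I+J))) (cancel-powers x·xinv≈1 I J)
      weights : (pow Q (suc a) * pow Q (j ⊓ b)) * pow qinv J ≈ pow Q (i ⊓ a)
      weights = trans (*-congʳ (trans (sym (pow-+ Q (suc a) (j ⊓ b)))
                                      (reflexive (≡.cong (pow Q) (weight-balance a b i j i+j≡a+b)))))
                      (cancel-powers q·qinv≈1 (i ⊓ a) J)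

    reflect-sum : P * sumBelow (λ j → pow Q (j ⊓ b) * g (suc j)) N
                    ≈ sumBelow (λ i → pow Q (i ⊓ a) * f (suc i)) N
    reflect-sum = begin
      P * sumBelow (λ j → pow Q (j ⊓ b) * g (suc j)) N
        ≈⟨ sumBelow-scale P (λ j → pow Q (j ⊓ b) * g (suc j)) N ⟩
      sumBelow (λ j → P * (pow Q (j ⊓ b) * g (suc j))) N
        ≈⟨ sumBelow-reverse (λ j → P * (pow Q (j ⊓ b) * g (suc j))) N ⟩
      sumBelow (λ i → P * (pow Q ((N ∸ suc i) ⊓ b) * g (suc (N ∸ suc i)))) N
        ≈⟨ sumBelow-cong N termwise ⟩
      sumBelow (λ i → pow Q (i ⊓ a) * f (suc i)) N  ∎
      where
      -- the coefficient of x^{i+1} on the left is A at position n-(i+1)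
      -- from the left, which is the coefficient of y^{n-(i+1)} on the right
      termwise : ∀ i → i < N →
        P * (pow Q ((N ∸ suc i) ⊓ b) * g (suc (N ∸ suc i))) ≈ pow Q (i ⊓ a) * f (suc i)
      termwise i (s≤s i≤a+b) =
        trans (reflect-monomial i (a ℕ.+ b ∸ i) (ℕₚ.m+[n∸m]≡n i≤a+b) (A (qAtLeft n q (suc (a ℕ.+ b ∸ i)))))
              (reflexive (≡.cong (λ m → pow Q (i ⊓ a) * (sign (suc i) * A (qAtLeft n q m) * pow x (suc i)))
                                 (≡.sym (ℕₚ.+-∸-assoc 1 i≤a+b))))

    reflect-qinv : P * qinv ≈ pow Q a * E
    reflect-qinv = begin
      sign n * (Q * pow Q a) * pow x n * qinv
        ≈⟨ solve 5 (λ s Q Qa xn qi → s :* (Q :* Qa) :* xn :* qi := (Q :* qi) :* (Qa :* (s :* xn)))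
                 refl (sign n) Q (pow Q a) (pow x n) qinv ⟩
      (Q * qinv) * (pow Q a * E)  ≈⟨ *-congʳ q·qinv≈1 ⟩
      1# * (pow Q a * E)          ≈⟨ *-identityˡ _ ⟩
      pow Q a * E                 ∎

    reflect-Ẽ : P * (pow Q b * Ẽ) ≈ qinv
    reflect-Ẽ = begin
      P * (pow Q b * (sign n * pow y n))
        ≈⟨ *-congˡ (*-congˡ (*-congˡ (pow-* qinv xinv n))) ⟩
      sign n * pow Q (suc a) * pow x n * (pow Q b * (sign n * ((qinv * pow qinv N) * pow xinv n)))
        ≈⟨ solve 7 (λ s Qa xn Qb qi qN xin →
                      s :* Qa :* xn :* (Qb :* (s :* ((qi :* qN) :* xin)))
                      := (s :* s) :* ((Qa :* Qb) :* qN) :* (xn :* xin) :* qi)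
                 refl (sign n) (pow Q (suc a)) (pow x n) (pow Q b) qinv (pow qinv N) (pow xinv n) ⟩
      (sign n * sign n) * ((pow Q (suc a) * pow Q b) * pow qinv N) * (pow x n * pow xinv n) * qinv
        ≈⟨ *-congʳ (*-cong (*-cong (pow-inverse -1*-1≈1 n) powers-of-q) (pow-inverse x·xinv≈1 n)) ⟩
      1# * 1# * 1# * qinv
        ≈⟨ trans (*-congʳ (trans (*-identityʳ _) (*-identityʳ _))) (*-identityˡ qinv) ⟩
      qinv  ∎
      where
      powers-of-q : (pow Q (suc a) * pow Q b) * pow qinv N ≈ 1#
      powers-of-q = trans (*-congʳ (sym (pow-+ Q (suc a) b))) (pow-inverse q·qinv≈1 N)

    n∸k≡b+1 : n ∸ suc a ≡ suc b
    n∸k≡b+1 = ≡.trans (≡.cong (_∸ a) (≡.sym (ℕₚ.+-suc a b))) (ℕₚ.m+n∸m≡n a (suc b))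

    functional-equation :
      side q qinv (H n q A) (suc a) x ≈ P * side q qinv (H̃ n q A) (n ∸ suc a) y
    functional-equation = begin
      side q qinv (H n q A) (suc a) x
        ≈⟨ side-closed-form q qinv f E x N a (ℕₚ.m≤n⇒m≤1+n (ℕₚ.m≤m+n a b)) ⟩
      qinv + (Σf + pow Q a * E)
        ≈⟨ solve 3 (λ u v w → u :+ (v :+ w) := w :+ (v :+ u)) refl qinv Σf (pow Q a * E) ⟩
      pow Q a * E + (Σf + qinv)
        ≈⟨ +-cong reflect-qinv (+-cong reflect-sum reflect-Ẽ) ⟨
      P * qinv + (P * Σg + P * (pow Q b * Ẽ))
        ≈⟨ solve 4 (λ p u v w → p :* u :+ (p :* v :+ p :* w) := p :* (u :+ (v :+ w)))
                 refl P qinv Σg (pow Q b * Ẽ) ⟩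
      P * (qinv + (Σg + pow Q b * Ẽ))
        ≈⟨ *-congˡ (side-closed-form q qinv g Ẽ y N b (ℕₚ.m≤n⇒m≤1+n (ℕₚ.m≤n+m b a))) ⟨
      P * side q qinv (H̃ n q A) (suc b) y
        ≡⟨ ≡.cong (λ K → P * side q qinv (H̃ n q A) K y) n∸k≡b+1 ⟨
      P * side q qinv (H̃ n q A) (n ∸ suc a) y  ∎
      where
      Σf Σg : Carrier
      Σf = sumBelow (λ i → pow Q (i ⊓ a) * f (suc i)) N
      Σg = sumBelow (λ j → pow Q (j ⊓ b) * g (suc j)) N

lemma3p4 : ∀ {c ℓ : Level} (R : CommutativeRing c ℓ) →
  let open CommutativeRing R
      open DirichletPoly R
  in (n : ℕ) → 2 ≤ n →
     (A : (Fin (n ∸ 1) → ℕ) → Carrier) →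
     (q : ℕ) → Prime q →
     (k : ℕ) → 1 ≤ k → k ≤ n ∸ 1 →
     (qinv : Carrier) → ι q * qinv ≈ 1# →
     (x xinv : Carrier) → x * xinv ≈ 1# →
     side q qinv (H n q A) k x
       ≈ sign n * pow (ι q) k * pow x n
           * side q qinv (H̃ n q A) (n ∸ k) (qinv * xinv)
-- Write n = m + 2 and k = a + 1 ≤ m + 1, so m = a + b for some b.
lemma3p4 R (suc (suc m)) _ A q _ (suc a) (s≤s z≤n) k≤m+1 qinv q·qinv≈1 x xinv x·xinv≈1
  with ℕₚ.m≤n⇒∃[o]m+o≡n (ℕₚ.≤-pred k≤m+1)
... | b , ≡.refl =
  FunctionalEquation.Reflection.functional-equation R a b q A qinv q·qinv≈1 x xinv x·xinv≈1
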